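{- Let $q$ be a prime power and $2\leqslant k\leqslant q+2$. Then the Atkin operator $U_t$ acting on $S^1_k(\Gamma_1(t))$ is diagonalizable over $\mathbb{C}_\infty$.
   Context: Let $A=\mathbb{F}_q[t]$, $F_\infty=\mathbb{F}_q((1/t))$, $\mathbb{C}_\infty$ the completion of an algebraic closure of $F_\infty$, and $\Omega=\mathbb{P}^1(\mathbb{C}_\infty)-\mathbb{P}^1(F_\infty)$ the Drinfeld upper half plane. Let $\Gamma_1(t)=\{\gamma\in GL_2(A):\gamma\equiv\left(\begin{smallmatrix}1&*\\0&1\end{smallmatrix}\right)\pmod t\}$. $S^1_k(\Gamma_1(t))$ is the $\mathbb{C}_\infty$-space of Drinfeld cusp forms of weight $k$ for $\Gamma_1(t)$: rigid analytic $f:\Omega\to\mathbb{C}_\infty$ with $f(\gamma z)(cz+d)^{ -k}=f(z)$ for all $\gamma=\left(\begin{smallmatrix}a&b\\c&d\end{smallmatrix}\right)\in\Gamma_1(t)$, holomorphic and vanishing at all cusps. The Atkin operator is $U_t(f)(z)=\sum_{\beta\in\mathbb{F}_q}f\big(\frac{z+\beta}{t}\big)$ (up to a nonzero normalizing scalar). Via Teitelbaum's isomorphism with harmonic cocycles, $S^1_k(\Gamma_1(t))$ has a basis $c_0,\dots,c_{k-2}$ on which $$U_t(c_j)=-(-t)^{j+1}\binom{k-2-j}{j}c_j-t^{j+1}\sum_{h\neq 0}\left[\binom{k-2-j-h(q-1)}{ -h(q-1)}+(-1)^{j+1}\binom{k-2-j-h(q-1)}{j}\right]c_{j+h(q-1)},$$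 with $c_i=0$ for $i\notin[0,k-2]$, binomial coefficients reduced into $\mathbb{F}_p\subset\mathbb{C}_\infty$ and $\binom{n}{m}=0$ if $m<0$ or $m>n$. -}

module Defs where

open import Level using (_⊔_)
open import Algebra.Bundles using (CommutativeRing)
open import Data.Nat as ℕ using (ℕ; zero; suc; _∸_)
open import Data.Nat.Divisibility using (_∣_; _∣?_)
open import Data.Integer as ℤ using (ℤ; +_; -[1+_])
open import Data.Fin using (Fin; toℕ)
open import Data.List using (List; []; _∷_; _++_; [_]; map)
open import Data.List.Relation.Unary.Any using (Any)
open import Data.Product using (Σ; ∃; _×_)
open import Relation.Nullary using (¬_; does)
open import Data.Bool using (if_then_else_)

binom : ℕ → ℕ → ℕ
binom n zero = 1
binom zero (suc m) = 0
binom (suc n) (suc m) = binom n m ℕ.+ binom n (suc m)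

-- Binomial coefficient with integer arguments, following the paper's
-- convention: (n choose m) = 0 if m < 0 or m > n (so also whenever n < 0).
binomℤ : ℤ → ℤ → ℕ
binomℤ (+ n) (+ m) = binom n m
binomℤ (+ n) -[1+ m ] = 0
binomℤ -[1+ n ] _ = 0

module _ {c ℓ} (K : CommutativeRing c ℓ) where
  open CommutativeRing K

  IsField : Set (c ⊔ ℓ)
  IsField = (¬ (1# ≈ 0#)) × (∀ x → ¬ (x ≈ 0#) → ∃ λ y → (x * y) ≈ 1#)

  -- Image of a natural number in K (so binomials are reduced into F_p ⊂ K).
  ι : ℕ → Carrier
  ι zero = 0#
  ι (suc n) = 1# + ι n

  pow : Carrier → ℕ → Carrier
  pow x zero = 1#
  pow x (suc n) = x * pow x n

  HasChar : ℕ → Set ℓ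
  HasChar p = ι p ≈ 0#

  evalPoly : List Carrier → Carrier → Carrier
  evalPoly [] x = 0#
  evalPoly (a ∷ as) x = a + x * evalPoly as x

  -- K is algebraically closed: every monic polynomial of degree ≥ 1 has a root.
  AlgClosed : Set (c ⊔ ℓ)
  AlgClosed = ∀ (a : Carrier) (as : List Carrier) →
              ∃ λ x → evalPoly ((a ∷ as) ++ [ 1# ]) x ≈ 0#

  -- t is transcendental over the prime field F_p: no nonzero polynomial
  -- with coefficients in F_p (= natural numbers not all divisible by p)
  -- vanishes at t.
  TranscendentalOver𝔽 : ℕ → Carrier → Set ℓ
  TranscendentalOver𝔽 p t =
    ∀ (cs : List ℕ) → Any (λ n → ¬ (p ∣ n)) cs → ¬ (evalPoly (map ι cs) t ≈ 0#)

  Mat : ℕ → Set c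
  Mat n = Fin n → Fin n → Carrier

  sumFin : (n : ℕ) → (Fin n → Carrier) → Carrier
  sumFin zero f = 0#
  sumFin (suc n) f = f Fin.zero + sumFin n (λ i → f (Fin.suc i))
    where import Data.Fin as Fin

  _·_ : ∀ {n} → Mat n → Mat n → Mat n
  _·_ {n} A B i j = sumFin n (λ l → A i l * B l j)

  idMat : ∀ {n} → Mat n
  idMat i j = if does (toℕ i ℕ.≟ toℕ j) then 1# else 0#

  diagMat : ∀ {n} → (Fin n → Carrier) → Mat n
  diagMat d i j = if does (toℕ i ℕ.≟ toℕ j) then d i else 0#

  _≈ₘ_ : ∀ {n} → Mat n → Mat n → Set ℓ
  A ≈ₘ B = ∀ i j → A i j ≈ B i j

  Diagonalizable : ∀ {n} → Mat n → Set (c ⊔ ℓ)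
  Diagonalizable {n} M =
    Σ (Mat n) λ P → Σ (Mat n) λ Q → Σ (Fin n → Carrier) λ d →
      ((P · Q) ≈ₘ idMat) × ((Q · P) ≈ₘ idMat) × ((M · P) ≈ₘ (P · diagMat d))

  -- Matrix of U_t on S¹_k(Γ₁(t)) in the basis c₀,…,c_{k-2} (dimension k-1):
  -- entry (i , j) is the coefficient of c_i in U_t(c_j).  Writing i = j + h(q-1)
  -- with h ≠ 0, i.e. d = i - j ≠ 0 and (q-1) ∣ d, the off-diagonal coefficient is
  --   -t^{j+1} [ C(k-2-j-d, -d) + (-1)^{j+1} C(k-2-j-d, j) ].
  UtMatrix : (q k : ℕ) → (t : Carrier) → Mat (k ∸ 1)
  UtMatrix q k t i j =
    if does (iₙ ℕ.≟ jₙ)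
      then - (pow (- t) (suc jₙ) * ι (binom (k ∸ 2 ∸ jₙ) jₙ))
      else (if does ((q ∸ 1) ∣? ℤ.∣ d ∣)
              then - (pow t (suc jₙ) *
                        (ι (binomℤ top (ℤ.- d))
                         + pow (- 1#) (suc jₙ) * ι (binomℤ top (+ jₙ))))
              else 0#)
    where
      iₙ = toℕ i
      jₙ = toℕ j
      d : ℤ
      d = (+ iₙ) ℤ.- (+ jₙ)
      top : ℤ
      top = (+ k) ℤ.- (+ 2) ℤ.- (+ jₙ) ℤ.- d

-- The coefficient of c_i in U_t(c_j) vanishes off the diagonal unless (q - 1) divides
-- i - j.  As the matrix has size k - 1 ≤ q + 1, this leaves at most the positions with
-- |i - j| = q - 1 (for q = 2 every position).  The proof is by explicit eigenbases:
--   * Matrices: if N² = 0 and the columns of I + N are eigenvectors of M, then M is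
--     diagonalized by I + N with inverse I - N.  Specialised to "column corrections"
--     (column j of the eigenbasis is e_j + c_j e_(σ j)), this covers every matrix with
--     at most one nonzero off-diagonal entry per column, placed in a diagonal column.
--   * Entries: the coefficients of U_t in closed form, and where they can be nonzero.
--   * Characteristic: q = 0 and (-1)^q = -1 in K.
--   * Diagonalisation: the cases k ≤ q (diagonal), k = q + 1 (one correction),
--     k = q + 2 with q ≥ 3 (two corrections) and q = 2, k = 4 (an explicit 3 × 3
--     eigenbasis); the theorem then just selects the case.

module Submission where

open import Algebra.Bundles using (CommutativeRing)
import Algebra.Solver.Ring
open import Algebra.Solver.Ring.AlmostCommutativeRing using (fromCommutativeRing; _-Raw-AlmostCommutative⟶_)
open import Data.Integer as ℤ using (ℤ; +_; -[1+_]; sign; ∣_∣)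
import Data.Integer.Solver
import Data.Integer.Properties as ℤP
open import Data.Maybe as Maybe using (Maybe)
open import Data.Nat as ℕ using (ℕ; zero; suc; _∸_; _≤_; _<_; z≤n; s≤s)
import Data.Nat.Properties as ℕP
open import Data.Sign as Sign using (Sign)
open import Relation.Binary.PropositionalEquality as ≡ using (_≡_; _≢_)
open import Relation.Nullary using (yes; no; ¬_)
open import Relation.Nullary.Decidable using (dec-true; dec-false)
open import Relation.Binary.Consequences using (dec⇒weaklyDec)
open import Data.Fin as Fin using (Fin; toℕ)
import Data.Vec
import Data.Fin.Properties as FinP
open import Data.Product using (_,_)
open import Data.Sum using (_⊎_; inj₁; inj₂)
open import Data.Nat.Divisibility using (_∣_; _∣?_; ∣-refl; _∣0; ∣m∣n⇒∣m+n; ∣1⇒≡1)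
open import Data.Nat.Primality using (Prime; prime[2]; prime⇒irreducible; euclidsLemma; prime⇒nonTrivial)
open import Data.Empty using (⊥-elim)
open import Defs

module RingArithmetic {r ℓ} (K : CommutativeRing r ℓ) where
  open CommutativeRing K
  open import Algebra.Properties.Ring ring using (-‿involutive; -1*x≈-x; -‿+-comm; -0#≈0#)
  open import Algebra.Properties.Semiring.Mult.TCOptimised semiring using (_×_; ×-homo-+; ×1-homo-*; 1+×)
  open import Relation.Binary.Reasoning.Setoid setoid

  ι≈× : ∀ n → ι K n ≈ n × 1#
  ι≈× zero = refl
  ι≈× (suc n) = trans (+-congˡ (ι≈× n)) (sym (1+× n 1#))

  -- The canonical ring map ℤ → K.  Nonnegative integers use the optimised
  -- multiple, for which 1 ↦ 1# holds definitionally.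
  ⟦_⟧ℤ : ℤ → Carrier
  ⟦ + n ⟧ℤ = n × 1#
  ⟦ -[1+ n ] ⟧ℤ = - (suc n × 1#)

  solve-for : ∀ {x a b} → x + b ≈ a → x ≈ a - b
  solve-for {x} {a} {b} e = begin
    x              ≈⟨ +-identityʳ x ⟨
    x + 0#         ≈⟨ +-congˡ (-‿inverseʳ b) ⟨
    x + (b - b)    ≈⟨ +-assoc x b (- b) ⟨
    (x + b) - b    ≈⟨ +-congʳ e ⟩
    a - b          ∎

  neg-unique : ∀ {x y} → x + y ≈ 0# → y ≈ - x
  neg-unique {x} {y} x+y≈0 = trans (solve-for (trans (+-comm y x) x+y≈0)) (+-identityˡ (- x))

  ×-suc : ∀ n → suc n × 1# ≈ n × 1# + 1#
  ×-suc n = trans (1+× n 1#) (+-comm _ _)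

  ⟦⊖⟧+ : ∀ m n → ⟦ m ℤ.⊖ n ⟧ℤ + n × 1# ≈ m × 1#
  ⟦⊖⟧+ m zero = +-identityʳ _
  ⟦⊖⟧+ zero (suc n) = -‿inverseˡ _
  ⟦⊖⟧+ (suc m) (suc n) = begin
    ⟦ suc m ℤ.⊖ suc n ⟧ℤ + suc n × 1#   ≡⟨ ≡.cong (λ i → ⟦ i ⟧ℤ + suc n × 1#) (ℤP.[1+m]⊖[1+n]≡m⊖n m n) ⟩
    ⟦ m ℤ.⊖ n ⟧ℤ + suc n × 1#           ≈⟨ +-congˡ (×-suc n) ⟩
    ⟦ m ℤ.⊖ n ⟧ℤ + (n × 1# + 1#)        ≈⟨ +-assoc _ _ _ ⟨
    (⟦ m ℤ.⊖ n ⟧ℤ + n × 1#) + 1#        ≈⟨ +-congʳ (⟦⊖⟧+ m n) ⟩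
    m × 1# + 1#                          ≈⟨ ×-suc m ⟨
    suc m × 1#                           ∎

  ⟦⊖⟧ : ∀ m n → ⟦ m ℤ.⊖ n ⟧ℤ ≈ m × 1# - n × 1#
  ⟦⊖⟧ m n = solve-for (⟦⊖⟧+ m n)

  ⟦+⟧ : ∀ i j → ⟦ i ℤ.+ j ⟧ℤ ≈ ⟦ i ⟧ℤ + ⟦ j ⟧ℤ
  ⟦+⟧ (+ m) (+ n) = ×-homo-+ 1# m n
  ⟦+⟧ (+ m) -[1+ n ] = ⟦⊖⟧ m (suc n)
  ⟦+⟧ -[1+ m ] (+ n) = trans (⟦⊖⟧ n (suc m)) (+-comm _ _)
  ⟦+⟧ -[1+ m ] -[1+ n ] = begin
    - (suc (suc (m ℕ.+ n)) × 1#)        ≡⟨ ≡.cong (λ x → - (suc x × 1#)) (ℕP.+-suc m n) ⟨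
    - ((suc m ℕ.+ suc n) × 1#)          ≈⟨ -‿cong (×-homo-+ 1# (suc m) (suc n)) ⟩
    - (suc m × 1# + suc n × 1#)         ≈⟨ -‿+-comm _ _ ⟨
    - (suc m × 1#) - (suc n × 1#)       ∎

  ⟦-⟧ : ∀ i → ⟦ ℤ.- i ⟧ℤ ≈ - ⟦ i ⟧ℤ
  ⟦-⟧ (+ zero) = sym -0#≈0#
  ⟦-⟧ (+ suc n) = refl
  ⟦-⟧ -[1+ n ] = sym (-‿involutive _)

  ⟦_⟧ₛ : Sign → Carrier
  ⟦ Sign.+ ⟧ₛ = 1#
  ⟦ Sign.- ⟧ₛ = - 1#

  ⟦◃⟧ : ∀ s n → ⟦ s ℤ.◃ n ⟧ℤ ≈ ⟦ s ⟧ₛ * (n × 1#)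
  ⟦◃⟧ s zero = sym (zeroʳ _)
  ⟦◃⟧ Sign.+ (suc n) = sym (*-identityˡ _)
  ⟦◃⟧ Sign.- (suc n) = sym (-1*x≈-x _)

  ⟦sign⟧ : ∀ s r → ⟦ s Sign.* r ⟧ₛ ≈ ⟦ s ⟧ₛ * ⟦ r ⟧ₛ
  ⟦sign⟧ Sign.+ r = sym (*-identityˡ _)
  ⟦sign⟧ Sign.- Sign.+ = sym (*-identityʳ _)
  ⟦sign⟧ Sign.- Sign.- = trans (sym (-‿involutive 1#)) (sym (-1*x≈-x _))

  ⟦*⟧ : ∀ i j → ⟦ i ℤ.* j ⟧ℤ ≈ ⟦ i ⟧ℤ * ⟦ j ⟧ℤ
  ⟦*⟧ i j = begin
    ⟦ (sign i Sign.* sign j) ℤ.◃ (∣ i ∣ ℕ.* ∣ j ∣) ⟧ℤ     ≈⟨ ⟦◃⟧ (sign i Sign.* sign j) (∣ i ∣ ℕ.* ∣ j ∣) ⟩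
    ⟦ sign i Sign.* sign j ⟧ₛ * ((∣ i ∣ ℕ.* ∣ j ∣) × 1#)   ≈⟨ *-cong (⟦sign⟧ (sign i) (sign j)) (×1-homo-* ∣ i ∣ ∣ j ∣) ⟩
    (⟦ sign i ⟧ₛ * ⟦ sign j ⟧ₛ) * (∣ i ∣ × 1# * ∣ j ∣ × 1#) ≈⟨ *-swap ⟩
    (⟦ sign i ⟧ₛ * ∣ i ∣ × 1#) * (⟦ sign j ⟧ₛ * ∣ j ∣ × 1#) ≈⟨ *-cong (sign-abs i) (sign-abs j) ⟨
    ⟦ i ⟧ℤ * ⟦ j ⟧ℤ                                        ∎
    where
    sign-abs : ∀ i → ⟦ i ⟧ℤ ≈ ⟦ sign i ⟧ₛ * (∣ i ∣ × 1#)
    sign-abs i = trans (reflexive (≡.cong ⟦_⟧ℤ (≡.sym (ℤP.◃-inverse i)))) (⟦◃⟧ (sign i) ∣ i ∣)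
    *-swap : ∀ {a b x y} → (a * b) * (x * y) ≈ (a * x) * (b * y)
    *-swap {a} {b} {x} {y} = begin
      (a * b) * (x * y)  ≈⟨ *-assoc a b (x * y) ⟩
      a * (b * (x * y))  ≈⟨ *-congˡ (*-assoc b x y) ⟨
      a * ((b * x) * y)  ≈⟨ *-congˡ (*-congʳ (*-comm b x)) ⟩
      a * ((x * b) * y)  ≈⟨ *-congˡ (*-assoc x b y) ⟩
      a * (x * (b * y))  ≈⟨ *-assoc a x (b * y) ⟨
      (a * x) * (b * y)  ∎

  ℤ→K : CommutativeRing.rawRing ℤP.+-*-commutativeRing -Raw-AlmostCommutative⟶ fromCommutativeRing K
  ℤ→K = record
    { ⟦_⟧ = ⟦_⟧ℤ ; +-homo = ⟦+⟧ ; *-homo = ⟦*⟧ ; -‿homo = ⟦-⟧ ; 0-homo = refl ; 1-homo = refl }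

  -- equal integer coefficients, as needed by the solver to drop zero terms
  coeff≟ : ∀ i j → Maybe (⟦ i ⟧ℤ ≈ ⟦ j ⟧ℤ)
  coeff≟ i j = Maybe.map (λ { ≡.refl → refl }) (dec⇒weaklyDec ℤ._≟_ i j)

  open Algebra.Solver.Ring (CommutativeRing.rawRing ℤP.+-*-commutativeRing) (fromCommutativeRing K) ℤ→K coeff≟
    public using (solve; prove; _:=_; _:+_; _:*_; :-_; _:-_; con; var; Polynomial; ⟦_⟧; ⟦_⟧↓)

-- Sums, products and diagonalization of square matrices over K.
module Matrices {r ℓ} (K : CommutativeRing r ℓ) where
  open CommutativeRing K
  open RingArithmetic K using (solve; _:=_; _:+_; _:*_; con)
  open import Algebra.Properties.Ring ring using (-‿+-comm; -0#≈0#; -‿distribˡ-*; -‿distribʳ-*)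
  open import Relation.Binary.Reasoning.Setoid setoid

  Σ : (n : ℕ) → (Fin n → Carrier) → Carrier
  Σ = sumFin K

  infixl 7 _⊙_
  _⊙_ : ∀ {n} → Mat K n → Mat K n → Mat K n
  _⊙_ = _·_ K

  δ : ∀ {n} → Fin n → Fin n → Carrier
  δ = idMat K

  δ-diag : ∀ {n} (i : Fin n) → δ i i ≈ 1#
  δ-diag i rewrite dec-true (toℕ i ℕ.≟ toℕ i) ≡.refl = refl

  δ-off : ∀ {n} {i j : Fin n} → i ≢ j → δ i j ≈ 0#
  δ-off {i = i} {j} i≢j rewrite dec-false (toℕ i ℕ.≟ toℕ j) (λ e → i≢j (FinP.toℕ-injective e)) = refl

  Σ-cong : ∀ n {f g : Fin n → Carrier} → (∀ l → f l ≈ g l) → Σ n f ≈ Σ n g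
  Σ-cong zero f≈g = refl
  Σ-cong (suc n) f≈g = +-cong (f≈g Fin.zero) (Σ-cong n (λ l → f≈g (Fin.suc l)))

  Σ-zero : ∀ n {f : Fin n → Carrier} → (∀ l → f l ≈ 0#) → Σ n f ≈ 0#
  Σ-zero zero f≈0 = refl
  Σ-zero (suc n) f≈0 = trans (+-cong (f≈0 Fin.zero) (Σ-zero n (λ l → f≈0 (Fin.suc l)))) (+-identityʳ 0#)

  Σ-+ : ∀ n (f g : Fin n → Carrier) → Σ n (λ l → f l + g l) ≈ Σ n f + Σ n g
  Σ-+ zero f g = sym (+-identityʳ 0#)
  Σ-+ (suc n) f g = trans (+-congˡ (Σ-+ n (λ l → f (Fin.suc l)) (λ l → g (Fin.suc l))))
    (solve 4 (λ a b x y → (a :+ b) :+ (x :+ y) := (a :+ x) :+ (b :+ y)) refl (f Fin.zero) (g Fin.zero) _ _)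

  Σ-neg : ∀ n (f : Fin n → Carrier) → Σ n (λ l → - f l) ≈ - Σ n f
  Σ-neg zero f = sym -0#≈0#
  Σ-neg (suc n) f = trans (+-congˡ (Σ-neg n (λ l → f (Fin.suc l)))) (-‿+-comm _ _)

  Σ-δʳ : ∀ n (f : Fin n → Carrier) (a : Fin n) → Σ n (λ l → f l * δ l a) ≈ f a
  Σ-δʳ (suc n) f Fin.zero = trans (+-cong (*-identityʳ _) (Σ-zero n (λ l → zeroʳ _))) (+-identityʳ _)
  Σ-δʳ (suc n) f (Fin.suc a) = trans (+-cong (zeroʳ _) (Σ-δʳ n (λ l → f (Fin.suc l)) a)) (+-identityˡ _)

  Σ-δˡ : ∀ n (f : Fin n → Carrier) (a : Fin n) → Σ n (λ l → δ a l * f l) ≈ f a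
  Σ-δˡ n f a = trans (Σ-cong n (λ l → *-comm _ _)) (trans (Σ-cong n (λ l → *-congˡ (δ-sym a l))) (Σ-δʳ n f a))
    where
    δ-sym : ∀ {n} (a l : Fin n) → δ a l ≈ δ l a
    δ-sym a l with a Fin.≟ l
    ... | yes ≡.refl = refl
    ... | no a≢l = trans (δ-off a≢l) (sym (δ-off (λ e → a≢l (≡.sym e))))

  ·-diag : ∀ {n} (A : Mat K n) (d : Fin n → Carrier) i j → (_·_ K A (diagMat K d)) i j ≈ A i j * d j
  ·-diag {n} A d i j = trans (Σ-cong n (λ l → trans (*-congˡ (diag≈ l)) (sym (*-assoc _ _ _)))) (Σ-δʳ n (λ l → A i l * d j) j)
    where
    diag≈ : ∀ l → diagMat K d l j ≈ d j * δ l j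
    diag≈ l with l Fin.≟ j
    ... | yes ≡.refl rewrite dec-true (toℕ l ℕ.≟ toℕ l) ≡.refl = sym (*-identityʳ _)
    ... | no l≢j rewrite dec-false (toℕ l ℕ.≟ toℕ j) (λ e → l≢j (FinP.toℕ-injective e)) = sym (zeroʳ _)

  I+ : ∀ {n} → Mat K n → Mat K n
  I+ A i j = δ i j + A i j

  I+-inverse : ∀ {n} (A B : Mat K n) → (∀ i j → A i j + B i j ≈ 0#) → (∀ i j → (A ⊙ B) i j ≈ 0#) →
               _≈ₘ_ K (I+ A ⊙ I+ B) (idMat K)
  I+-inverse {n} A B A+B≈0 AB≈0 i j = begin
    Σ n (λ l → (δ i l + A i l) * (δ l j + B l j))
      ≈⟨ Σ-cong n (λ l → expand (δ i l) (A i l) (δ l j) (B l j)) ⟩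
    Σ n (λ l → δ i l * δ l j + (δ i l * B l j + (A i l * δ l j + A i l * B l j)))
      ≈⟨ trans (Σ-+ n _ _) (+-congˡ (trans (Σ-+ n _ _) (+-congˡ (Σ-+ n _ _)))) ⟩
    Σ n (λ l → δ i l * δ l j) + (Σ n (λ l → δ i l * B l j) + (Σ n (λ l → A i l * δ l j) + (A ⊙ B) i j))
      ≈⟨ +-cong (Σ-δˡ n (λ l → δ l j) i) (+-cong (Σ-δˡ n (λ l → B l j) i) (+-cong (Σ-δʳ n (A i) j) (AB≈0 i j))) ⟩
    δ i j + (B i j + (A i j + 0#))
      ≈⟨ +-congˡ (trans (solve 2 (λ a b → b :+ (a :+ con (+ 0)) := a :+ b) refl (A i j) (B i j)) (A+B≈0 i j)) ⟩
    δ i j + 0#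
      ≈⟨ +-identityʳ _ ⟩
    δ i j ∎
    where
    expand : ∀ a b x y → (a + b) * (x + y) ≈ a * x + (a * y + (b * x + b * y))
    expand = solve 4 (λ a b x y → (a :+ b) :* (x :+ y) := a :* x :+ (a :* y :+ (b :* x :+ b :* y))) refl

  -- If N² = 0 and the columns of I + N are eigenvectors of M with eigenvalues d,
  -- then M is diagonalized by I + N, whose inverse is I - N.
  square-zero-eigenbasis : ∀ {n} (M N : Mat K n) (d : Fin n → Carrier) →
                           (∀ i j → (N ⊙ N) i j ≈ 0#) →
                           (∀ i j → (M ⊙ I+ N) i j ≈ I+ N i j * d j) →
                           Diagonalizable K M
  square-zero-eigenbasis {n} M N d N²≈0 eigen =
    I+ N , I+ -N , d , I+-inverse N -N (λ i j → -‿inverseʳ (N i j)) N·-N ,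
    I+-inverse -N N (λ i j → -‿inverseˡ (N i j)) -N·N , MP
    where
    -N : Mat K n
    -N i j = - N i j
    -N² : ∀ i j → - (N ⊙ N) i j ≈ 0#
    -N² i j = trans (-‿cong (N²≈0 i j)) -0#≈0#
    N·-N : ∀ i j → (N ⊙ -N) i j ≈ 0#
    N·-N i j = trans (Σ-cong n (λ l → sym (-‿distribʳ-* _ _))) (trans (Σ-neg n _) (-N² i j))
    -N·N : ∀ i j → (-N ⊙ N) i j ≈ 0#
    -N·N i j = trans (Σ-cong n (λ l → sym (-‿distribˡ-* _ _))) (trans (Σ-neg n _) (-N² i j))
    MP : _≈ₘ_ K (M ⊙ I+ N) (I+ N ⊙ diagMat K d)
    MP i j = trans (eigen i j) (sym (·-diag (I+ N) d i j))

  Diagonalizable-resp : ∀ {n} {M M′ : Mat K n} → _≈ₘ_ K M M′ → Diagonalizable K M′ → Diagonalizable K M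
  Diagonalizable-resp {n} M≈M′ (P , Q , d , PQ , QP , M′P) =
    P , Q , d , PQ , QP , λ i j → trans (Σ-cong n (λ l → *-congʳ (M≈M′ i l))) (M′P i j)

  -- Suppose M is diagonal except possibly at the positions
  -- (σ j , j), where σ sends each column either to itself or to a column fixed by σ.
  -- If for every moved column j the vector e_j + c_j e_(σ j) is an eigenvector of M
  -- for the eigenvalue M j j, then these vectors form an eigenbasis of M.
  module ColumnCorrections {n} (M : Mat K n) (σ : Fin n → Fin n) (c : Fin n → Carrier)
    (σ-idem : ∀ j → σ (σ j) ≡ σ j)
    (c-fixed : ∀ j → σ j ≡ j → c j ≈ 0#)
    (sparse : ∀ i j → i ≢ j → i ≢ σ j → M i j ≈ 0#)
    (eigen : ∀ j → σ j ≢ j → M (σ j) j + c j * M (σ j) (σ j) ≈ c j * M j j)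
    where
    N : Mat K n
    N i j = c j * δ i (σ j)

    -- N² = 0 because σ j is never moved, so c (σ j) = 0.
    N²≈0 : ∀ i j → (N ⊙ N) i j ≈ 0#
    N²≈0 i j = begin
      Σ n (λ l → (c l * δ i (σ l)) * (c j * δ l (σ j)))
        ≈⟨ Σ-cong n (λ l → solve 4 (λ a b x y → (a :* b) :* (x :* y) := (a :* b :* x) :* y) refl _ _ _ _) ⟩
      Σ n (λ l → (c l * δ i (σ l) * c j) * δ l (σ j))
        ≈⟨ Σ-δʳ n (λ l → c l * δ i (σ l) * c j) (σ j) ⟩
      c (σ j) * δ i (σ (σ j)) * c j
        ≈⟨ *-congʳ (*-congʳ (c-fixed (σ j) (σ-idem j))) ⟩
      0# * δ i (σ (σ j)) * c j
        ≈⟨ solve 2 (λ x y → con (+ 0) :* x :* y := con (+ 0)) refl _ _ ⟩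
      0# ∎

    M·I+N : ∀ i j → (M ⊙ I+ N) i j ≈ M i j + c j * M i (σ j)
    M·I+N i j = begin
      Σ n (λ l → M i l * (δ l j + c j * δ l (σ j)))
        ≈⟨ Σ-cong n (λ l → solve 4 (λ m x a y → m :* (x :+ a :* y) := m :* x :+ (a :* m) :* y) refl _ _ _ _) ⟩
      Σ n (λ l → M i l * δ l j + (c j * M i l) * δ l (σ j))
        ≈⟨ Σ-+ n _ _ ⟩
      Σ n (λ l → M i l * δ l j) + Σ n (λ l → (c j * M i l) * δ l (σ j))
        ≈⟨ +-cong (Σ-δʳ n (M i) j) (Σ-δʳ n (λ l → c j * M i l) (σ j)) ⟩
      M i j + c j * M i (σ j) ∎

    -- entry (i , j) of M (I + N) = (I + N) diag(M), once the values of the entries are known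
    shape : ∀ {x x′ y y′ d d′ e e′ a a′ m} → x ≈ x′ → y ≈ y′ → d ≈ d′ → e ≈ e′ → a ≈ a′ →
            x′ + a′ * y′ ≈ (d′ + a′ * e′) * m → x + a * y ≈ (d + a * e) * m
    shape x≈ y≈ d≈ e≈ a≈ eq =
      trans (+-cong x≈ (*-cong a≈ y≈)) (trans eq (*-congʳ (sym (+-cong d≈ (*-cong a≈ e≈)))))

    σσ≢ : ∀ {i j} → i ≢ σ j → i ≢ σ (σ j)
    σσ≢ {j = j} i≢σj e = i≢σj (≡.trans e (σ-idem j))

    column-entry : ∀ i j → M i j + c j * M i (σ j) ≈ (δ i j + c j * δ i (σ j)) * M j j
    column-entry i j with σ j Fin.≟ j | i Fin.≟ j | i Fin.≟ σ j
    -- an unmoved column is (M j j) e_j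
    ... | yes σj≡j | yes ≡.refl | _ = shape refl refl (δ-diag j) refl (c-fixed j σj≡j)
      (solve 3 (λ y e m → m :+ con (+ 0) :* y := (con (+ 1) :+ con (+ 0) :* e) :* m) refl _ _ _)
    ... | yes σj≡j | no i≢j | _ = shape (sparse i j i≢j (λ e → i≢j (≡.trans e σj≡j))) refl (δ-off i≢j) refl (c-fixed j σj≡j)
      (solve 3 (λ y e m → con (+ 0) :+ con (+ 0) :* y := (con (+ 0) :+ con (+ 0) :* e) :* m) refl _ _ _)
    -- in a moved column the entries at j and at σ j are the eigenvector equation
    ... | no σj≢j | yes ≡.refl | _ = shape refl (sparse j (σ j) (λ e → σj≢j (≡.sym e)) (σσ≢ (λ e → σj≢j (≡.sym e))))
                                          (δ-diag j) (δ-off (λ e → σj≢j (≡.sym e))) refl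
      (solve 2 (λ a m → m :+ a :* con (+ 0) := (con (+ 1) :+ a :* con (+ 0)) :* m) refl _ _)
    ... | no σj≢j | no i≢j | yes ≡.refl = shape refl refl (δ-off i≢j) (δ-diag (σ j)) refl
      (trans (eigen j σj≢j) (solve 2 (λ a m → a :* m := (con (+ 0) :+ a :* con (+ 1)) :* m) refl _ _))
    -- elsewhere the column vanishes
    ... | no σj≢j | no i≢j | no i≢σj =
      shape (sparse i j i≢j i≢σj) (sparse i (σ j) i≢σj (σσ≢ i≢σj)) (δ-off i≢j) (δ-off i≢σj) refl
      (solve 2 (λ a m → con (+ 0) :+ a :* con (+ 0) := (con (+ 0) :+ a :* con (+ 0)) :* m) refl _ _)

    diagonalizable : Diagonalizable K M
    diagonalizable = square-zero-eigenbasis M N (λ j → M j j) N²≈0 (λ i j → trans (M·I+N i j) (column-entry i j))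

module Distance where
  open import Data.Nat.Divisibility using (divides)

  ∣⊖∣ : ∀ x y → ∣ x ℤ.⊖ y ∣ ≡ ℕ.∣ x - y ∣
  ∣⊖∣ zero zero = ≡.refl
  ∣⊖∣ zero (suc y) = ≡.refl
  ∣⊖∣ (suc x) zero = ≡.refl
  ∣⊖∣ (suc x) (suc y) = ≡.trans (≡.cong ∣_∣ (ℤP.[1+m]⊖[1+n]≡m⊖n x y)) (∣⊖∣ x y)

  ∣+-+∣ : ∀ x y → ∣ + x ℤ.- + y ∣ ≡ ℕ.∣ x - y ∣
  ∣+-+∣ x y = ≡.trans (≡.cong ∣_∣ (ℤP.m-n≡m⊖n x y)) (∣⊖∣ x y)

  ∣m+n-m∣≡n : ∀ m n → ℕ.∣ m ℕ.+ n - m ∣ ≡ n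
  ∣m+n-m∣≡n m n = ≡.trans (ℕP.m≤n⇒∣n-m∣≡n∸m (ℕP.m≤m+n m n)) (ℕP.m+n∸m≡n m n)

  toℕ-apart : ∀ {n} {i j : Fin n} {x y} → toℕ i ≡ x → toℕ j ≡ y → x ≢ y → i ≢ j
  toℕ-apart i≡x j≡y x≢y i≡j = x≢y (≡.trans (≡.sym i≡x) (≡.trans (≡.cong toℕ i≡j) j≡y))

  the-multiple : ∀ {a D} → a ∣ D → 0 < D → D < a ℕ.+ a → D ≡ a
  the-multiple (divides zero ≡.refl) ()
  the-multiple {a} (divides (suc zero) ≡.refl) _ _ = ℕP.+-identityʳ a
  the-multiple {a} (divides (suc (suc m)) ≡.refl) _ D<2a =
    ⊥-elim (ℕP.<⇒≱ D<2a (ℕP.+-monoʳ-≤ a (ℕP.m≤m+n a (m ℕ.* a))))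

  apart-by : ∀ {a n x y} → x < n → y < n → n ≤ a ℕ.+ a → x ≢ y → a ∣ ℕ.∣ x - y ∣ →
             x ≡ y ℕ.+ a ⊎ y ≡ x ℕ.+ a
  apart-by {a} {n} {x} {y} x<n y<n n≤2a x≢y a∣ with ℕP.≤-total x y
  ... | inj₁ x≤y = inj₂ (≡.trans (≡.sym (ℕP.m+[n∸m]≡n x≤y)) (≡.cong (x ℕ.+_) step))
    where
    step : y ∸ x ≡ a
    step = the-multiple (≡.subst (a ∣_) (ℕP.m≤n⇒∣m-n∣≡n∸m x≤y) a∣)
                        (ℕP.m<n⇒0<n∸m (ℕP.≤∧≢⇒< x≤y x≢y))
                        (ℕP.<-≤-trans (ℕP.≤-<-trans (ℕP.m∸n≤m y x) y<n) n≤2a)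
  ... | inj₂ y≤x = inj₁ (≡.trans (≡.sym (ℕP.m+[n∸m]≡n y≤x)) (≡.cong (y ℕ.+_) step))
    where
    step : x ∸ y ≡ a
    step = the-multiple (≡.subst (a ∣_) (ℕP.m≤n⇒∣n-m∣≡n∸m y≤x) a∣)
                        (ℕP.m<n⇒0<n∸m (ℕP.≤∧≢⇒< y≤x (λ e → x≢y (≡.sym e))))
                        (ℕP.<-≤-trans (ℕP.≤-<-trans (ℕP.m∸n≤m x y) x<n) n≤2a)

module Binomial where
  binom-above : ∀ n m → n < m → binom n m ≡ 0
  binom-above zero (suc m) _ = ≡.refl
  binom-above (suc n) (suc m) (s≤s n<m) = ≡.cong₂ ℕ._+_ (binom-above n m n<m) (binom-above n (suc m) (ℕP.m<n⇒m<1+n n<m))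

  binom-diag : ∀ n → binom n n ≡ 1
  binom-diag zero = ≡.refl
  binom-diag (suc n) = ≡.cong₂ ℕ._+_ (binom-diag n) (binom-above n (suc n) ℕP.≤-refl)

  binom-sub : ∀ n → binom (suc n) n ≡ suc n
  binom-sub zero = ≡.refl
  binom-sub (suc n) = ≡.trans (≡.cong₂ ℕ._+_ (binom-sub n) (binom-diag (suc n))) (ℕP.+-comm (suc n) 1)

  binom-one : ∀ n → binom n 1 ≡ n
  binom-one zero = ≡.refl
  binom-one (suc n) = ≡.cong suc (binom-one n)

  binomℤ-below : ∀ N x y → x < y → binomℤ (+ N) (x ℤ.⊖ y) ≡ 0
  binomℤ-below N zero (suc y) _ = ≡.refl
  binomℤ-below N (suc x) (suc y) (s≤s x<y) = ≡.trans (≡.cong (binomℤ (+ N)) (ℤP.[1+m]⊖[1+n]≡m⊖n x y)) (binomℤ-below N x y x<y)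

module Entries {r ℓ} (K : CommutativeRing r ℓ) (q k : ℕ) (t : CommutativeRing.Carrier K) where
  open CommutativeRing K
  open RingArithmetic K using (solve; _:=_; _:+_; _:*_; :-_; con)
  open import Relation.Binary.Reasoning.Setoid setoid

  U : Mat K (k ∸ 1)
  U = UtMatrix K q k t

  -- the index distance q - 1 at which the off-diagonal coefficients live
  a : ℕ
  a = q ∸ 1

  diag-coeff : ℕ → ℕ → Carrier
  diag-coeff y B = - (pow K (- t) (suc y) * ι K B)
  off-coeff : ℕ → ℕ → ℕ → Carrier
  off-coeff y B₁ B₂ = - (pow K t (suc y) * (ι K B₁ + pow K (- 1#) (suc y) * ι K B₂))

  U-diag : ∀ j {y} → toℕ j ≡ y → U j j ≡ diag-coeff y (binom (k ∸ 2 ∸ y) y)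
  U-diag j ≡.refl rewrite dec-true (toℕ j ℕ.≟ toℕ j) ≡.refl = ≡.refl

  U-far : ∀ i j → i ≢ j → ¬ (a ∣ ℕ.∣ toℕ i - toℕ j ∣) → U i j ≡ 0#
  U-far i j i≢j a∤
    rewrite dec-false (toℕ i ℕ.≟ toℕ j) (λ e → i≢j (FinP.toℕ-injective e))
          | dec-false (a ∣? ∣ + toℕ i ℤ.- + toℕ j ∣) (λ a∣ → a∤ (≡.subst (a ∣_) (Distance.∣+-+∣ (toℕ i) (toℕ j)) a∣))
    = ≡.refl

  2+i≤k : ∀ (i : Fin (k ∸ 1)) → 2 ℕ.+ toℕ i ≤ k
  2+i≤k i = ≡.subst (_≤ k) (ℕP.+-comm (suc (toℕ i)) 1)
                 (ℕP.m≤o∸n⇒m+n≤o (suc (toℕ i)) 1≤k (FinP.toℕ<n i))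
    where
    1≤k : 1 ≤ k
    1≤k = ℕP.≤-trans (s≤s z≤n) (ℕP.≤-trans (FinP.toℕ<n i) (ℕP.m∸n≤m k 1))

  -- The off-diagonal coefficient for i - j = h(q - 1) ≠ 0: both binomials have top
  -- k - 2 - j - h(q - 1) = k - 2 - i, and the first has bottom -h(q - 1) = j - i.
  U-off : ∀ i j → i ≢ j → a ∣ ℕ.∣ toℕ i - toℕ j ∣ →
          U i j ≡ off-coeff (toℕ j) (binomℤ (+ (k ∸ (2 ℕ.+ toℕ i))) (toℕ j ℤ.⊖ toℕ i)) (binom (k ∸ (2 ℕ.+ toℕ i)) (toℕ j))
  U-off i j i≢j a∣
    rewrite dec-false (toℕ i ℕ.≟ toℕ j) (λ e → i≢j (FinP.toℕ-injective e))
          | dec-true (a ∣? ∣ + toℕ i ℤ.- + toℕ j ∣) (≡.subst (a ∣_) (≡.sym (Distance.∣+-+∣ (toℕ i) (toℕ j))) a∣)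
    = ≡.cong₂ (λ top h → off-coeff (toℕ j) (binomℤ top h) (binomℤ top (+ toℕ j))) top≡ -d≡
    where
    open Data.Integer.Solver.+-*-Solver using ()
      renaming (solve to solveℤ; _:=_ to _:=ℤ_; _:-_ to _:-ℤ_; _:+_ to _:+ℤ_; con to conℤ)
    top-identity : ∀ k i j → k ℤ.- + 2 ℤ.- j ℤ.- (i ℤ.- j) ≡ k ℤ.- (+ 2 ℤ.+ i)
    top-identity = solveℤ 3 (λ k i j → k :-ℤ conℤ (+ 2) :-ℤ j :-ℤ (i :-ℤ j) :=ℤ k :-ℤ (conℤ (+ 2) :+ℤ i)) ≡.refl
    top≡ : + k ℤ.- + 2 ℤ.- + toℕ j ℤ.- (+ toℕ i ℤ.- + toℕ j) ≡ + (k ∸ (2 ℕ.+ toℕ i))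
    top≡ = ≡.trans (top-identity (+ k) (+ toℕ i) (+ toℕ j))
                   (≡.trans (ℤP.m-n≡m⊖n k (2 ℕ.+ toℕ i)) (ℤP.⊖-≥ (2+i≤k i)))
    -d≡ : ℤ.- (+ toℕ i ℤ.- + toℕ j) ≡ toℕ j ℤ.⊖ toℕ i
    -d≡ = ≡.trans (≡.cong ℤ.-_ (ℤP.m-n≡m⊖n (toℕ i) (toℕ j))) (≡.sym (ℤP.⊖-swap (toℕ j) (toℕ i)))

  support : k ∸ 1 ≤ a ℕ.+ a → ∀ i j → i ≢ j →
            U i j ≡ 0# ⊎ (toℕ i ≡ toℕ j ℕ.+ a ⊎ toℕ j ≡ toℕ i ℕ.+ a)
  support n≤2a i j i≢j with a ∣? ℕ.∣ toℕ i - toℕ j ∣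
  ... | no a∤ = inj₁ (U-far i j i≢j a∤)
  ... | yes a∣ = inj₂ (Distance.apart-by (FinP.toℕ<n i) (FinP.toℕ<n j) n≤2a (λ e → i≢j (FinP.toℕ-injective e)) a∣)

  shifted-index : ∀ {m} → k ∸ 1 ≡ m ℕ.+ a → ∀ i {x} → toℕ i ≡ x ℕ.+ a → x < m
  shifted-index {m} n≡m+a i {x} i≡x+a = ℕP.+-cancelʳ-< a x m (≡.subst₂ _<_ i≡x+a n≡m+a (FinP.toℕ<n i))

  -- The coefficient of c_{y+(q-1)} in U_t(c_y): the first binomial has negative bottom.
  U-below : ∀ i j {x y} → toℕ i ≡ x → toℕ j ≡ y → 0 < a → x ≡ y ℕ.+ a →
            U i j ≡ off-coeff y 0 (binom (k ∸ (2 ℕ.+ x)) y)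
  U-below i j ≡.refl ≡.refl 0<a x≡y+a =
    ≡.trans (U-off i j i≢j a∣)
            (≡.cong (λ B₁ → off-coeff (toℕ j) B₁ (binom (k ∸ (2 ℕ.+ toℕ i)) (toℕ j))) (Binomial.binomℤ-below _ _ _ y<x))
    where
    y<x : toℕ j < toℕ i
    y<x = ≡.subst (toℕ j <_) (≡.sym x≡y+a) (ℕP.m<m+n (toℕ j) 0<a)
    i≢j : i ≢ j
    i≢j e = ℕP.<⇒≢ y<x (≡.cong toℕ (≡.sym e))
    a∣ : a ∣ ℕ.∣ toℕ i - toℕ j ∣
    a∣ = ≡.subst (a ∣_) (≡.sym (≡.trans (≡.cong (ℕ.∣_- toℕ j ∣) x≡y+a) (Distance.∣m+n-m∣≡n (toℕ j) a))) ∣-refl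

  U-above : ∀ i j {x y} → toℕ i ≡ x → toℕ j ≡ y → 0 < a → y ≡ x ℕ.+ a →
            U i j ≡ off-coeff y (binom (k ∸ (2 ℕ.+ x)) a) (binom (k ∸ (2 ℕ.+ x)) y)
  U-above i j ≡.refl ≡.refl 0<a y≡x+a =
    ≡.trans (U-off i j i≢j a∣) (≡.cong (λ h → off-coeff (toℕ j) (binomℤ top h) (binom (k ∸ (2 ℕ.+ toℕ i)) (toℕ j))) j⊖i≡a)
    where
    x<y : toℕ i < toℕ j
    x<y = ≡.subst (toℕ i <_) (≡.sym y≡x+a) (ℕP.m<m+n (toℕ i) 0<a)
    i≢j : i ≢ j
    i≢j e = ℕP.<⇒≢ x<y (≡.cong toℕ e)
    a∣ : a ∣ ℕ.∣ toℕ i - toℕ j ∣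
    a∣ = ≡.subst (a ∣_) (≡.sym (≡.trans (≡.cong (ℕ.∣ toℕ i -_∣) y≡x+a) (ℕP.∣m-m+n∣≡n (toℕ i) a))) ∣-refl
    top : ℤ
    top = + (k ∸ (2 ℕ.+ toℕ i))
    j⊖i≡a : toℕ j ℤ.⊖ toℕ i ≡ + a
    j⊖i≡a = ≡.trans (ℤP.⊖-≥ (ℕP.<⇒≤ x<y)) (≡.cong +_ (≡.trans (≡.cong (_∸ toℕ i) y≡x+a) (ℕP.m+n∸m≡n (toℕ i) a)))

  U-00 : ∀ o → toℕ o ≡ 0 → U o o ≈ t
  U-00 o o≡0 = trans (reflexive (U-diag o o≡0))
                     (solve 1 (λ x → :- ((:- x :* con (+ 1)) :* (con (+ 1) :+ con (+ 0))) := x) refl t)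

  U-a0 : ∀ i j → toℕ i ≡ a → toℕ j ≡ 0 → 0 < a → U i j ≈ t
  U-a0 i j i≡a j≡0 0<a = trans (reflexive (U-below i j i≡a j≡0 0<a ≡.refl))
    (solve 1 (λ x → :- ((x :* con (+ 1)) :* (con (+ 0) :+ (:- con (+ 1) :* con (+ 1)) :* (con (+ 1) :+ con (+ 0)))) := x) refl t)

  -- If the coefficient of c_{q-1} in U_t(c_{q-1}) vanishes, then e₀ + e_{q-1} is an
  -- eigenvector for t: this is the equation of column 0 in the eigenbasis.
  column-0-eigen : ∀ o z → toℕ o ≡ 0 → toℕ z ≡ a → 0 < a → U z z ≈ 0# →
                   U z o + 1# * U z z ≈ 1# * U o o
  column-0-eigen o z o≡0 z≡a 0<a Uzz≈0 = begin
    U z o + 1# * U z z  ≈⟨ +-cong (U-a0 z o z≡a o≡0 0<a) (*-congˡ Uzz≈0) ⟩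
    t + 1# * 0#         ≈⟨ solve 1 (λ x → x :+ con (+ 1) :* con (+ 0) := con (+ 1) :* x) refl t ⟩
    1# * t              ≈⟨ *-congˡ (U-00 o o≡0) ⟨
    1# * U o o          ∎

  U-diag-zero : ∀ j {y} → toℕ j ≡ y → k ∸ 2 ∸ y < y → U j j ≈ 0#
  U-diag-zero j {y} j≡y small = begin
    U j j                             ≡⟨ U-diag j j≡y ⟩
    diag-coeff y (binom (k ∸ 2 ∸ y) y) ≡⟨ ≡.cong (diag-coeff y) (Binomial.binom-above _ _ small) ⟩
    - (pow K (- t) (suc y) * 0#)      ≈⟨ solve 1 (λ x → :- (x :* con (+ 0)) := con (+ 0)) refl _ ⟩
    0#                                ∎

  U-0a : ∀ i j → toℕ i ≡ 0 → toℕ j ≡ a → 0 < a →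
         U i j ≈ - (pow K t (suc a) * ((1# + pow K (- 1#) (suc a)) * ι K (binom (k ∸ 2) a)))
  U-0a i j i≡0 j≡a 0<a = trans (reflexive (U-above i j i≡0 j≡a 0<a ≡.refl))
    (solve 3 (λ x s b → :- (x :* (b :+ s :* b)) := :- (x :* ((con (+ 1) :+ s) :* b))) refl _ _ _)

-- Arithmetic of q = p^e inside a ring of characteristic p.
module Characteristic {r ℓ} (K : CommutativeRing r ℓ) where
  open CommutativeRing K
  open RingArithmetic K using (ι≈×; neg-unique; solve; _:=_; _:*_; :-_; con)
  open import Algebra.Properties.Semiring.Mult.TCOptimised semiring using (×1-homo-*)
  open import Relation.Binary.Reasoning.Setoid setoid

  ι-* : ∀ m n → ι K (m ℕ.* n) ≈ ι K m * ι K n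
  ι-* m n = trans (ι≈× (m ℕ.* n)) (trans (×1-homo-* m n) (sym (*-cong (ι≈× m) (ι≈× n))))

  ι-pow : ∀ {p} e → ι K p ≈ 0# → 1 ≤ e → ι K (p ℕ.^ e) ≈ 0#
  ι-pow {p} (suc e) ι[p]≈0 _ = trans (ι-* p (p ℕ.^ e)) (trans (*-congʳ ι[p]≈0) (zeroˡ _))

  odd-power : ∀ n → ¬ (2 ∣ n) → pow K (- 1#) n ≈ - 1#
  odd-power zero 2∤0 = ⊥-elim (2∤0 (2 ∣0))
  odd-power (suc zero) _ = *-identityʳ (- 1#)
  odd-power (suc (suc n)) 2∤n+2 = begin
    - 1# * (- 1# * pow K (- 1#) n) ≈⟨ *-congˡ (*-congˡ (odd-power n (λ 2∣n → 2∤n+2 (∣m∣n⇒∣m+n ∣-refl 2∣n)))) ⟩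
    - 1# * (- 1# * - 1#)           ≈⟨ solve 0 (:- con (+ 1) :* (:- con (+ 1) :* :- con (+ 1)) := :- con (+ 1)) refl ⟩
    - 1#                           ∎

  -- in characteristic 2, -1 = 1, so all powers of -1 are -1
  char-2-power : ι K 2 ≈ 0# → ∀ n → pow K (- 1#) n ≈ - 1#
  char-2-power ι[2]≈0 n = trans (power-of-one n) 1≈-1
    where
    1≈-1 : 1# ≈ - 1#
    1≈-1 = trans (sym (+-identityʳ 1#)) (neg-unique ι[2]≈0)
    power-of-one : ∀ n → pow K (- 1#) n ≈ 1#
    power-of-one zero = refl
    power-of-one (suc n) = trans (*-cong (sym 1≈-1) (power-of-one n)) (*-identityʳ 1#)

  minus-one-power : ∀ {p} → Prime p → ι K p ≈ 0# → ∀ e → pow K (- 1#) (p ℕ.^ e) ≈ - 1#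
  minus-one-power {p} p-prime ι[p]≈0 e with 2 ∣? p
  ... | yes 2∣p with prime⇒irreducible p-prime 2∣p
  ...   | inj₁ ()
  ...   | inj₂ ≡.refl = char-2-power ι[p]≈0 (2 ℕ.^ e)
  minus-one-power {p} p-prime ι[p]≈0 e | no 2∤p = odd-power (p ℕ.^ e) (odd e)
    where
    odd : ∀ e → ¬ (2 ∣ p ℕ.^ e)
    odd zero 2∣1 with ∣1⇒≡1 2∣1
    ... | ()
    odd (suc e) 2∣pᵉ⁺¹ with euclidsLemma p (p ℕ.^ e) prime[2] 2∣pᵉ⁺¹
    ... | inj₁ 2∣p = 2∤p 2∣p
    ... | inj₂ 2∣pᵉ = odd e 2∣pᵉ

-- The four cases of Theorem 3.1, for a fixed t.
module Diagonalisation {r ℓ} (K : CommutativeRing r ℓ) (t : CommutativeRing.Carrier K) where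
  open CommutativeRing K
  open RingArithmetic K using (solve; prove; _:=_; _:+_; _:*_; :-_; _:-_; con; var; Polynomial; ⟦_⟧; ⟦_⟧↓; neg-unique)
  open Matrices K using (module ColumnCorrections; Diagonalizable-resp; _⊙_; ·-diag)
  open import Relation.Binary.Reasoning.Setoid setoid

  -- k ≤ q: the matrix has size < q - 1, so no two indices are q - 1 apart and it is diagonal.
  diagonal-case : ∀ q k → k ≤ q → Diagonalizable K (UtMatrix K q k t)
  diagonal-case q k k≤q =
    ColumnCorrections.diagonalizable U (λ j → j) (λ _ → 0#) (λ _ → ≡.refl) (λ _ _ → refl) sparse
                                     (λ j j≢j → ⊥-elim (j≢j ≡.refl))
    where
    open Entries K q k t
    n≤a : k ∸ 1 ≤ a
    n≤a = ℕP.∸-monoˡ-≤ 1 k≤q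
    too-far : ∀ i j → toℕ i ≢ toℕ j ℕ.+ a
    too-far i j e = ℕP.<⇒≱ (ℕP.<-≤-trans (FinP.toℕ<n i) n≤a) (≡.subst (a ≤_) (≡.sym e) (ℕP.m≤n+m a (toℕ j)))
    sparse : ∀ i j → i ≢ j → i ≢ j → U i j ≈ 0#
    sparse i j i≢j _ with support (ℕP.≤-trans n≤a (ℕP.m≤n+m a a)) i j i≢j
    ... | inj₁ Uij≡0 = reflexive Uij≡0
    ... | inj₂ (inj₁ i≡j+a) = ⊥-elim (too-far i j i≡j+a)
    ... | inj₂ (inj₂ j≡i+a) = ⊥-elim (too-far j i j≡i+a)

  -- k = q + 1 with q = 2 + b: the only nonzero off-diagonal coefficient is t at
  -- (q - 1, 0); the coefficient at (0, q - 1) vanishes because (-1)^q = -1.  Column 0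
  -- of the eigenbasis is e₀ + e_{q-1}.
  module OneCorrection (b : ℕ) ([-1]^q≈-1 : pow K (- 1#) (2 ℕ.+ b) ≈ - 1#) where
    open Entries K (2 ℕ.+ b) (3 ℕ.+ b) t

    z : Fin (2 ℕ.+ b)
    z = Fin.fromℕ (suc b)
    z≡a : toℕ z ≡ a
    z≡a = FinP.toℕ-fromℕ (suc b)

    σ : Fin (2 ℕ.+ b) → Fin (2 ℕ.+ b)
    σ Fin.zero = z
    σ (Fin.suc j) = Fin.suc j
    c : Fin (2 ℕ.+ b) → Carrier
    c Fin.zero = 1#
    c (Fin.suc j) = 0#

    σ-idem : ∀ j → σ (σ j) ≡ σ j
    σ-idem Fin.zero = ≡.refl
    σ-idem (Fin.suc j) = ≡.refl
    c-fixed : ∀ j → σ j ≡ j → c j ≈ 0#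
    c-fixed (Fin.suc j) _ = refl

    U-0a≈0 : ∀ i j → toℕ i ≡ 0 → toℕ j ≡ a → U i j ≈ 0#
    U-0a≈0 i j i≡0 j≡a = begin
      U i j
        ≈⟨ U-0a i j i≡0 j≡a (s≤s z≤n) ⟩
      - (pow K t (2 ℕ.+ b) * ((1# + pow K (- 1#) (2 ℕ.+ b)) * ι K (binom (suc b) (suc b))))
        ≈⟨ -‿cong (*-congˡ (*-cong (+-congˡ [-1]^q≈-1) (reflexive (≡.cong (ι K) (Binomial.binom-diag (suc b)))))) ⟩
      - (pow K t (2 ℕ.+ b) * ((1# + - 1#) * ι K 1))
        ≈⟨ solve 1 (λ x → :- (x :* ((con (+ 1) :+ :- con (+ 1)) :* (con (+ 1) :+ con (+ 0)))) := con (+ 0)) refl _ ⟩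
      0# ∎

    eigen : ∀ j → σ j ≢ j → U (σ j) j + c j * U (σ j) (σ j) ≈ c j * U j j
    eigen Fin.zero _ = column-0-eigen Fin.zero z ≡.refl z≡a (s≤s z≤n)
                         (U-diag-zero z z≡a (≡.subst (_< suc b) (≡.sym (ℕP.n∸n≡0 b)) (s≤s z≤n)))
    eigen (Fin.suc j) σj≢j = ⊥-elim (σj≢j ≡.refl)

    sparse : ∀ i j → i ≢ j → i ≢ σ j → U i j ≈ 0#
    sparse i j i≢j i≢σj with support (s≤s (ℕP.m≤n+m (suc b) b)) i j i≢j
    ... | inj₁ Uij≡0 = reflexive Uij≡0
    ... | inj₂ (inj₁ i≡j+a) = ⊥-elim (i≢σj (≡.trans i≡z (≡.cong σ (≡.sym j≡0))))
      where
      j≡0 : j ≡ Fin.zero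
      j≡0 = FinP.toℕ-injective (ℕP.n<1⇒n≡0 (shifted-index ≡.refl i i≡j+a))
      i≡z : i ≡ z
      i≡z = FinP.toℕ-injective (≡.trans i≡j+a (≡.trans (≡.cong (ℕ._+ a) (≡.cong toℕ j≡0)) (≡.sym z≡a)))
    ... | inj₂ (inj₂ j≡i+a) = U-0a≈0 i j i≡0 (≡.trans j≡i+a (≡.cong (ℕ._+ a) i≡0))
      where
      i≡0 : toℕ i ≡ 0
      i≡0 = ℕP.n<1⇒n≡0 (shifted-index ≡.refl j j≡i+a)

    diagonalizable : Diagonalizable K (UtMatrix K (2 ℕ.+ b) (3 ℕ.+ b) t)
    diagonalizable = ColumnCorrections.diagonalizable U σ c σ-idem c-fixed sparse eigen

  -- k = q + 2 with q = 3 + s: the nonzero off-diagonal coefficients are t at (q - 1, 0)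
  -- and -t^{q+1} at (1, q); those at (0, q - 1) and (q, 1) vanish since q = 0 in K.
  -- Columns 0 and q of the eigenbasis are e₀ + e_{q-1} and e_q + t^{q-1} e₁.
  module TwoCorrections (s : ℕ) (ι[q]≈0 : ι K (3 ℕ.+ s) ≈ 0#) where
    open Entries K (3 ℕ.+ s) (5 ℕ.+ s) t
    open Distance using (toℕ-apart)

    o u z w : Fin (4 ℕ.+ s)
    o = Fin.zero
    u = Fin.suc Fin.zero
    z = Fin.fromℕ< {2 ℕ.+ s} (s≤s (s≤s (s≤s (ℕP.n≤1+n s))))
    w = Fin.fromℕ (3 ℕ.+ s)
    z≡a : toℕ z ≡ a
    z≡a = FinP.toℕ-fromℕ< (s≤s (s≤s (s≤s (ℕP.n≤1+n s))))
    w≡1+a : toℕ w ≡ 1 ℕ.+ a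
    w≡1+a = FinP.toℕ-fromℕ (3 ℕ.+ s)

    U-uw : U u w ≈ - (t * (t * pow K t (2 ℕ.+ s)))
    U-uw = begin
      U u w
        ≡⟨ U-above u w ≡.refl w≡1+a (s≤s z≤n) ≡.refl ⟩
      off-coeff (3 ℕ.+ s) (binom (2 ℕ.+ s) (2 ℕ.+ s)) (binom (2 ℕ.+ s) (3 ℕ.+ s))
        ≡⟨ ≡.cong₂ (off-coeff (3 ℕ.+ s)) (Binomial.binom-diag (2 ℕ.+ s)) (Binomial.binom-above (2 ℕ.+ s) (3 ℕ.+ s) ℕP.≤-refl) ⟩
      - (t * (t * pow K t (2 ℕ.+ s)) * (ι K 1 + pow K (- 1#) (4 ℕ.+ s) * 0#))
        ≈⟨ solve 2 (λ p m → :- (p :* ((con (+ 1) :+ con (+ 0)) :+ m :* con (+ 0))) := :- p) refl _ _ ⟩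
      - (t * (t * pow K t (2 ℕ.+ s))) ∎
    U-uu : U u u ≈ t * t
    U-uu = begin
      U u u                               ≡⟨ U-diag u ≡.refl ⟩
      diag-coeff 1 (binom (2 ℕ.+ s) 1)    ≡⟨ ≡.cong (diag-coeff 1) (Binomial.binom-one (2 ℕ.+ s)) ⟩
      - (pow K (- t) 2 * ι K (2 ℕ.+ s))   ≈⟨ -‿cong (*-congˡ (neg-unique ι[q]≈0)) ⟩
      - (pow K (- t) 2 * - 1#)            ≈⟨ solve 1 (λ x → :- ((:- x :* (:- x :* con (+ 1))) :* :- con (+ 1)) := x :* x) refl t ⟩
      t * t                               ∎
    U-zz : U z z ≈ 0#
    U-zz = U-diag-zero z z≡a (≡.subst (_< 2 ℕ.+ s) (≡.sym (ℕP.m+n∸n≡m 1 s)) (s≤s (s≤s z≤n)))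
    U-ww : U w w ≈ 0#
    U-ww = U-diag-zero w w≡1+a (≡.subst (_< 3 ℕ.+ s) (≡.sym (ℕP.n∸n≡0 s)) (s≤s z≤n))

    U-0a≈0 : ∀ i j → toℕ i ≡ 0 → toℕ j ≡ a → U i j ≈ 0#
    U-0a≈0 i j i≡0 j≡a = begin
      U i j
        ≈⟨ U-0a i j i≡0 j≡a (s≤s z≤n) ⟩
      - (pow K t (3 ℕ.+ s) * ((1# + pow K (- 1#) (3 ℕ.+ s)) * ι K (binom (3 ℕ.+ s) (2 ℕ.+ s))))
        ≈⟨ -‿cong (*-congˡ (*-congˡ (trans (reflexive (≡.cong (ι K) (Binomial.binom-sub (2 ℕ.+ s)))) ι[q]≈0))) ⟩
      - (pow K t (3 ℕ.+ s) * ((1# + pow K (- 1#) (3 ℕ.+ s)) * 0#))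
        ≈⟨ solve 2 (λ x m → :- (x :* ((con (+ 1) :+ m) :* con (+ 0))) := con (+ 0)) refl _ _ ⟩
      0# ∎
    U-q1≈0 : ∀ i j → toℕ i ≡ 1 ℕ.+ a → toℕ j ≡ 1 → U i j ≈ 0#
    U-q1≈0 i j i≡1+a j≡1 = begin
      U i j                                 ≡⟨ U-below i j i≡1+a j≡1 (s≤s z≤n) ≡.refl ⟩
      off-coeff 1 0 (binom (s ∸ s) 1)       ≡⟨ ≡.cong (λ x → off-coeff 1 0 (binom x 1)) (ℕP.n∸n≡0 s) ⟩
      - (pow K t 2 * (0# + pow K (- 1#) 2 * 0#))
        ≈⟨ solve 2 (λ x m → :- (x :* (con (+ 0) :+ m :* con (+ 0))) := con (+ 0)) refl _ _ ⟩
      0#                                    ∎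

    σ : Fin (4 ℕ.+ s) → Fin (4 ℕ.+ s)
    σ j with j Fin.≟ o | j Fin.≟ w
    ... | yes _ | _ = z
    ... | no _ | yes _ = u
    ... | no _ | no _ = j
    c : Fin (4 ℕ.+ s) → Carrier
    c j with j Fin.≟ o | j Fin.≟ w
    ... | yes _ | _ = 1#
    ... | no _ | yes _ = pow K t (2 ℕ.+ s)
    ... | no _ | no _ = 0#

    z≢o : z ≢ o
    z≢o = toℕ-apart z≡a ≡.refl (λ ())
    z≢w : z ≢ w
    z≢w = toℕ-apart z≡a w≡1+a (ℕP.<⇒≢ (ℕP.n<1+n a))
    u≢w : u ≢ w
    u≢w = toℕ-apart ≡.refl w≡1+a (λ ())

    σ-o : σ o ≡ z
    σ-o = ≡.refl
    σ-w : σ w ≡ u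
    σ-w with w Fin.≟ o | w Fin.≟ w
    ... | yes w≡o | _ = ⊥-elim (toℕ-apart w≡1+a ≡.refl (λ ()) w≡o)
    ... | no _ | yes _ = ≡.refl
    ... | no _ | no w≢w = ⊥-elim (w≢w ≡.refl)
    σ-fixed : ∀ x → x ≢ o → x ≢ w → σ x ≡ x
    σ-fixed x x≢o x≢w with x Fin.≟ o | x Fin.≟ w
    ... | yes x≡o | _ = ⊥-elim (x≢o x≡o)
    ... | no _ | yes x≡w = ⊥-elim (x≢w x≡w)
    ... | no _ | no _ = ≡.refl

    σ-idem : ∀ j → σ (σ j) ≡ σ j
    σ-idem j with j Fin.≟ o | j Fin.≟ w
    ... | yes _ | _ = σ-fixed z z≢o z≢w
    ... | no _ | yes _ = σ-fixed u (λ ()) u≢w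
    ... | no j≢o | no j≢w = σ-fixed j j≢o j≢w
    c-fixed : ∀ j → σ j ≡ j → c j ≈ 0#
    c-fixed j σj≡j with j Fin.≟ o | j Fin.≟ w
    ... | yes j≡o | _ = ⊥-elim (z≢o (≡.trans σj≡j j≡o))
    ... | no _ | yes j≡w = ⊥-elim (u≢w (≡.trans σj≡j j≡w))
    ... | no _ | no _ = refl

    eigen : ∀ j → σ j ≢ j → U (σ j) j + c j * U (σ j) (σ j) ≈ c j * U j j
    eigen j σj≢j with j Fin.≟ o | j Fin.≟ w
    ... | yes ≡.refl | _ = column-0-eigen o z ≡.refl z≡a (s≤s z≤n) U-zz
    ... | no _ | yes ≡.refl = begin
      U u w + pow K t (2 ℕ.+ s) * U u u
        ≈⟨ +-cong U-uw (*-congˡ U-uu) ⟩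
      - (t * (t * pow K t (2 ℕ.+ s))) + pow K t (2 ℕ.+ s) * (t * t)
        ≈⟨ solve 2 (λ x p → :- (x :* (x :* p)) :+ p :* (x :* x) := p :* con (+ 0)) refl t (pow K t (2 ℕ.+ s)) ⟩
      pow K t (2 ℕ.+ s) * 0#
        ≈⟨ *-congˡ U-ww ⟨
      pow K t (2 ℕ.+ s) * U w w ∎
    ... | no _ | no _ = ⊥-elim (σj≢j ≡.refl)

    sparse : ∀ i j → i ≢ j → i ≢ σ j → U i j ≈ 0#
    sparse i j i≢j i≢σj with support (s≤s (s≤s (ℕP.m≤n+m (2 ℕ.+ s) s))) i j i≢j
    ... | inj₁ Uij≡0 = reflexive Uij≡0
    ... | inj₂ (inj₁ i≡j+a) with ℕP.n≤1⇒n≡0∨n≡1 (ℕ.s≤s⁻¹ (shifted-index ≡.refl i i≡j+a))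
    ...   | inj₁ j≡0 = ⊥-elim (i≢σj (≡.trans i≡z (≡.trans (≡.sym σ-o) (≡.cong σ (≡.sym j≡o)))))
      where
      j≡o : j ≡ o
      j≡o = FinP.toℕ-injective j≡0
      i≡z : i ≡ z
      i≡z = FinP.toℕ-injective (≡.trans i≡j+a (≡.trans (≡.cong (ℕ._+ a) j≡0) (≡.sym z≡a)))
    ...   | inj₂ j≡1 = U-q1≈0 i j (≡.trans i≡j+a (≡.cong (ℕ._+ a) j≡1)) j≡1
    sparse i j i≢j i≢σj | inj₂ (inj₂ j≡i+a) with ℕP.n≤1⇒n≡0∨n≡1 (ℕ.s≤s⁻¹ (shifted-index ≡.refl j j≡i+a))
    ...   | inj₁ i≡0 = U-0a≈0 i j i≡0 (≡.trans j≡i+a (≡.cong (ℕ._+ a) i≡0))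
    ...   | inj₂ i≡1 = ⊥-elim (i≢σj (≡.trans i≡u (≡.trans (≡.sym σ-w) (≡.cong σ (≡.sym j≡w)))))
      where
      i≡u : i ≡ u
      i≡u = FinP.toℕ-injective i≡1
      j≡w : j ≡ w
      j≡w = FinP.toℕ-injective (≡.trans j≡i+a (≡.trans (≡.cong (ℕ._+ a) i≡1) (≡.sym w≡1+a)))

    diagonalizable : Diagonalizable K (UtMatrix K (3 ℕ.+ s) (5 ℕ.+ s) t)
    diagonalizable = ColumnCorrections.diagonalizable U σ c σ-idem c-fixed sparse eigen

  -- q = 2, k = 4 (characteristic 2): every off-diagonal position is allowed.  In the
  -- basis c₀, c₁, c₂ the matrix is M = (t 0 0 ; t -t² -t³ ; t 0 0), with eigenvectors
  -- (1, 1 - t, 1), (0, 1, 0), (0, -t, 1) for t, -t², 0.  The identities PQ = QP = 1 and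
  -- MP = PD are polynomial identities in t, checked entry by entry by normalisation.
  module ThreeByThree (ι[2]≈0 : ι K 2 ≈ 0#) where
    ₀ ₁ ₂ : Fin 3
    ₀ = Fin.zero
    ₁ = Fin.suc Fin.zero
    ₂ = Fin.suc (Fin.suc Fin.zero)

    every-entry : ∀ {p} {P : Fin 3 → Fin 3 → Set p} →
                  P ₀ ₀ → P ₀ ₁ → P ₀ ₂ → P ₁ ₀ → P ₁ ₁ → P ₁ ₂ → P ₂ ₀ → P ₂ ₁ → P ₂ ₂ → ∀ i j → P i j
    every-entry p₀₀ p₀₁ p₀₂ p₁₀ p₁₁ p₁₂ p₂₀ p₂₁ p₂₂ = λ where
      Fin.zero Fin.zero → p₀₀
      Fin.zero (Fin.suc Fin.zero) → p₀₁
      Fin.zero (Fin.suc (Fin.suc Fin.zero)) → p₀₂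
      (Fin.suc Fin.zero) Fin.zero → p₁₀
      (Fin.suc Fin.zero) (Fin.suc Fin.zero) → p₁₁
      (Fin.suc Fin.zero) (Fin.suc (Fin.suc Fin.zero)) → p₁₂
      (Fin.suc (Fin.suc Fin.zero)) Fin.zero → p₂₀
      (Fin.suc (Fin.suc Fin.zero)) (Fin.suc Fin.zero) → p₂₁
      (Fin.suc (Fin.suc Fin.zero)) (Fin.suc (Fin.suc Fin.zero)) → p₂₂

    Matₚ : Set
    Matₚ = Fin 3 → Fin 3 → Polynomial 1

    ρ : Data.Vec.Vec Carrier 1
    ρ = t Data.Vec.∷ Data.Vec.[]
    ⟦_⟧ₘ : Matₚ → Mat K 3
    ⟦ A ⟧ₘ i j = ⟦ A i j ⟧ ρ

    _⊗_ : Matₚ → Matₚ → Matₚ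
    (A ⊗ B) i j = A i ₀ :* B ₀ j :+ (A i ₁ :* B ₁ j :+ (A i ₂ :* B ₂ j :+ con (+ 0)))

    by-normalisation : (A B : Matₚ) → (∀ i j → ⟦ A i j ⟧↓ ρ ≈ ⟦ B i j ⟧↓ ρ) → _≈ₘ_ K ⟦ A ⟧ₘ ⟦ B ⟧ₘ
    by-normalisation A B nf i j = prove ρ (A i j) (B i j) (nf i j)

    T 𝟘 𝟙 : Polynomial 1
    T = var Fin.zero
    𝟘 = con (+ 0)
    𝟙 = con (+ 1)

    Mₚ Pₚ Qₚ Iₚ : Matₚ
    Mₚ = every-entry T 𝟘 𝟘   T (:- (T :* T)) (:- (T :* (T :* T)))   T 𝟘 𝟘
    Pₚ = every-entry 𝟙 𝟘 𝟘   (𝟙 :- T) 𝟙 (:- T)   𝟙 𝟘 𝟙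
    Qₚ = every-entry 𝟙 𝟘 𝟘   (:- 𝟙) 𝟙 T   (:- 𝟙) 𝟘 𝟙
    Iₚ = every-entry 𝟙 𝟘 𝟘   𝟘 𝟙 𝟘   𝟘 𝟘 𝟙
    d : Fin 3 → Carrier
    d j = ⟦ Mₚ j j ⟧ ρ

    -- the entries of U_t given by the formula for q = 2, k = 4, before simplification
    Uₚ : Matₚ
    Uₚ = every-entry
      (:- ((:- T :* 𝟙) :* ι₁))                 (:- (T ^ 2 :* (ι₂ :+ (:- 𝟙) ^ 2 :* ι₂)))  (:- (T ^ 3 :* (ι₁ :+ (:- 𝟙) ^ 3 :* ι₁)))
      (:- (T ^ 1 :* (𝟘 :+ (:- 𝟙) ^ 1 :* ι₁)))  (:- ((:- T) ^ 2 :* ι₁))                  (:- (T ^ 3 :* (ι₁ :+ (:- 𝟙) ^ 3 :* 𝟘)))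
      (:- (T ^ 1 :* (𝟘 :+ (:- 𝟙) ^ 1 :* ι₁)))  (:- (T ^ 2 :* (𝟘 :+ (:- 𝟙) ^ 2 :* 𝟘)))   (:- ((:- T) ^ 3 :* 𝟘))
      where
      ι₁ ι₂ : Polynomial 1
      ι₁ = 𝟙 :+ 𝟘
      ι₂ = 𝟙 :+ ι₁
      _^_ : Polynomial 1 → ℕ → Polynomial 1
      x ^ zero = 𝟙
      x ^ suc n = x :* x ^ n

    U≈Uₚ : _≈ₘ_ K (UtMatrix K 2 4 t) ⟦ Uₚ ⟧ₘ
    U≈Uₚ = every-entry refl refl refl refl refl refl refl refl refl

    -- only the coefficient at (0, 1) needs 2 = 0
    Uₚ≈Mₚ : _≈ₘ_ K ⟦ Uₚ ⟧ₘ ⟦ Mₚ ⟧ₘ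
    Uₚ≈Mₚ = every-entry (norm ₀ ₀ refl) char-2 (norm ₀ ₂ refl)
                        (norm ₁ ₀ refl) (norm ₁ ₁ refl) (norm ₁ ₂ refl)
                        (norm ₂ ₀ refl) (norm ₂ ₁ refl) (norm ₂ ₂ refl)
      where
      norm : ∀ i j → ⟦ Uₚ i j ⟧↓ ρ ≈ ⟦ Mₚ i j ⟧↓ ρ → ⟦ Uₚ i j ⟧ ρ ≈ ⟦ Mₚ i j ⟧ ρ
      norm i j = prove ρ (Uₚ i j) (Mₚ i j)
      char-2 : ⟦ Uₚ ₀ ₁ ⟧ ρ ≈ 0#
      char-2 = trans (-‿cong (*-congˡ (+-cong ι[2]≈0 (*-congˡ ι[2]≈0))))
                     (solve 2 (λ x m → :- (x :* (con (+ 0) :+ m :* con (+ 0))) := con (+ 0)) refl _ _)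

    Iₚ≈1 : _≈ₘ_ K ⟦ Iₚ ⟧ₘ (idMat K)
    Iₚ≈1 = every-entry refl refl refl refl refl refl refl refl refl

    PQ : _≈ₘ_ K (⟦ Pₚ ⟧ₘ ⊙ ⟦ Qₚ ⟧ₘ) (idMat K)
    PQ i j = trans (by-normalisation (Pₚ ⊗ Qₚ) Iₚ (every-entry refl refl refl refl refl refl refl refl refl) i j) (Iₚ≈1 i j)
    QP : _≈ₘ_ K (⟦ Qₚ ⟧ₘ ⊙ ⟦ Pₚ ⟧ₘ) (idMat K)
    QP i j = trans (by-normalisation (Qₚ ⊗ Pₚ) Iₚ (every-entry refl refl refl refl refl refl refl refl refl) i j) (Iₚ≈1 i j)
    MP : _≈ₘ_ K (⟦ Mₚ ⟧ₘ ⊙ ⟦ Pₚ ⟧ₘ) (⟦ Pₚ ⟧ₘ ⊙ diagMat K d)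
    MP i j = trans (by-normalisation (Mₚ ⊗ Pₚ) (λ i j → Pₚ i j :* Mₚ j j) (every-entry refl refl refl refl refl refl refl refl refl) i j)
                   (sym (·-diag ⟦ Pₚ ⟧ₘ d i j))

    diagonalizable : Diagonalizable K (UtMatrix K 2 4 t)
    diagonalizable = Diagonalizable-resp (λ i j → trans (U≈Uₚ i j) (Uₚ≈Mₚ i j)) (⟦ Pₚ ⟧ₘ , ⟦ Qₚ ⟧ₘ , d , PQ , QP , MP)

  case-k≡q+2 : ∀ b → ι K (2 ℕ.+ b) ≈ 0# → Diagonalizable K (UtMatrix K (2 ℕ.+ b) (4 ℕ.+ b) t)
  case-k≡q+2 zero = ThreeByThree.diagonalizable
  case-k≡q+2 (suc s) = TwoCorrections.diagonalizable s

  U-diagonalizable : ∀ q k → 2 ≤ q → ι K q ≈ 0# → pow K (- 1#) q ≈ - 1# → k ≤ suc (suc q) →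
                     Diagonalizable K (UtMatrix K q k t)
  U-diagonalizable q k (s≤s (s≤s {n = b} z≤n)) ι[q]≈0 [-1]^q≈-1 k≤q+2 with ℕP.m≤n⇒m<n∨m≡n k≤q+2
  ... | inj₂ ≡.refl = case-k≡q+2 b ι[q]≈0
  ... | inj₁ (s≤s k≤q+1) with ℕP.m≤n⇒m<n∨m≡n k≤q+1
  ...   | inj₁ (s≤s k≤q) = diagonal-case q k k≤q
  ...   | inj₂ ≡.refl = OneCorrection.diagonalizable b [-1]^q≈-1

open import Data.Nat using (_+_; _^_)

prime-power≥2 : ∀ {p} e → Prime p → 1 ≤ e → 2 ≤ p ^ e
prime-power≥2 {p} e p-prime 1≤e =
  ℕP.≤-trans (ℕ.nonTrivial⇒n>1 p) (≡.subst (_≤ p ^ e) (ℕP.*-identityʳ p) (ℕP.^-monoʳ-≤ p 1≤e))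
  where
  instance
    p-nontrivial : ℕ.NonTrivial p
    p-nontrivial = prime⇒nonTrivial p-prime
    p-nonzero : ℕ.NonZero p
    p-nonzero = ℕ.nonTrivial⇒nonZero p

theorem3p1 : ∀ {c ℓ} (K : CommutativeRing c ℓ) → IsField K → AlgClosed K →
    (p e q : ℕ) → Prime p → 1 ≤ e → q ≡ p ^ e → HasChar K p →
    (t : CommutativeRing.Carrier K) → TranscendentalOver𝔽 K p t →
    (k : ℕ) → 2 ≤ k → k ≤ q + 2 →
    Diagonalizable K (UtMatrix K q k t)
theorem3p1 K _ _ p e q p-prime 1≤e ≡.refl char-p t _ k _ k≤q+2 =
  U-diagonalizable q k (prime-power≥2 e p-prime 1≤e)
                   (ι-pow e char-p 1≤e)
                   (minus-one-power p-prime char-p e)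
                   (≡.subst (k ≤_) (ℕP.+-comm q 2) k≤q+2)
  where
  open Diagonalisation K t using (U-diagonalizable)
  open Characteristic K using (ι-pow; minus-one-power)
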